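{- Let $d$ and $s$ be positive integers and let $\lambda$ be a partition. Then $\lambda$ is an $(s,s+1)$-core partition with $d$-distinct parts if and only if $\beta(\lambda)$ is a $d$-th order twin-free subset of $\{1,2,\ldots,s-1\}$.
   Context: A partition $\lambda=(\lambda_1,\ldots,\lambda_l)$ is a finite nonincreasing sequence of positive integers; it has $d$-distinct parts if $\lambda_i-\lambda_{i+1}\ge d$ for all $1\le i\le l-1$. For the box in row $i$, column $j$ of the Young diagram of $\lambda$, the hook length $h(i,j)$ is the number of boxes directly to its right, plus the number directly below it, plus one. $\lambda$ is an $(s_1,\ldots,s_t)$-core partition if no box has hook length equal to any of $s_1,\ldots,s_t$. The set $\beta(\lambda)=\{h(i,1):1\le i\le l\}$ is the set of first-column hook lengths. A set $X\subseteq\mathbb{N}$ is a $d$-th order twin-free set if there is no $x\in X$ and no $k$ with $1\le k\le d$ such that $\{x,x+k\}\subseteq X$. -}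

module Defs where

open import Data.Nat using (ℕ; zero; suc; _+_; _∸_; _≤_; _<_; _≤?_)
open import Data.List using (List; []; _∷_; length; filter; drop)
open import Data.List.Relation.Unary.All using (All)
open import Data.List.Relation.Unary.Linked using (Linked)
open import Data.Product using (Σ; ∃; _×_)
open import Relation.Binary.PropositionalEquality using (_≡_; _≢_)
open import Relation.Nullary using (¬_)

IsPartition : List ℕ → Set
IsPartition λs = All (λ x → 0 < x) λs × Linked (λ a b → b ≤ a) λs

-- part λ i = λ_i (1-indexed); 0 if i = 0 or i > length λ.
part : List ℕ → ℕ → ℕ
part [] _ = 0
part (x ∷ xs) zero = 0
part (x ∷ xs) (suc zero) = x
part (x ∷ xs) (suc (suc i)) = part xs (suc i)

Box : List ℕ → ℕ → ℕ → Set
Box λs i j = (1 ≤ i) × (i ≤ length λs) × (1 ≤ j) × (j ≤ part λs i)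

arm : List ℕ → ℕ → ℕ → ℕ
arm λs i j = part λs i ∸ j

leg : List ℕ → ℕ → ℕ → ℕ
leg λs i j = length (filter (j ≤?_) (drop i λs))

hook : List ℕ → ℕ → ℕ → ℕ
hook λs i j = arm λs i j + leg λs i j + 1

IsCore : List ℕ → List ℕ → Set
IsCore ts λs = All (λ t → ∀ i j → Box λs i j → hook λs i j ≢ t) ts

DDistinct : ℕ → List ℕ → Set
DDistinct d λs = ∀ i → 1 ≤ i → suc i ≤ length λs → d + part λs (suc i) ≤ part λs i

β : List ℕ → ℕ → Set
β λs x = Σ ℕ (λ i → (1 ≤ i) × (i ≤ length λs) × (hook λs i 1 ≡ x))

TwinFree : ℕ → (ℕ → Set) → Set
TwinFree d X = ¬ (Σ ℕ (λ x → Σ ℕ (λ k → (1 ≤ k) × (k ≤ d) × X x × X (x + k))))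

SubsetUpTo : ℕ → (ℕ → Set) → Set
SubsetUpTo n X = ∀ x → X x → (1 ≤ x) × (x ≤ n)

module Submission where

-- Write β_i = λ_i + (l − i) for the hook length of the first box of row i; these numbers
-- form β(λ).  The proof rests on two facts about a single row i.
--   (1) Hook lengths decrease along a row, so every hook of row i is at most β_i.
--   (2) If the parts below row i are strictly decreasing, consecutive hooks of the row drop
--       by at most 2, and the last box has hook 1; by a discrete intermediate value theorem
--       a row with β_i ≥ s then contains a box of hook length s or s + 1.
-- Hence, for partitions with distinct parts (d ≥ 1), being an (s, s+1)-core is equivalent to
-- β(λ) ⊆ {1, …, s − 1}.  For the twin-free condition we use β_i − β_{i+1} = λ_i − λ_{i+1} + 1:
-- d-distinct parts means consecutive β-numbers differ by at least d + 1, such a sequence has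
-- all pairwise gaps above d, hence a twin-free image; conversely twin-freeness forces the
-- consecutive gaps.

open import Defs
open import Data.Nat using (ℕ; suc; _≤_; _∸_)
open import Data.List using (List; []; _∷_)
open import Data.Product using (_×_)
open import Function.Bundles using (_⇔_; mk⇔; Equivalence)

open import Data.Nat using (zero; _+_; _<_; _>_; _≥_; _≰_; _≤?_; z≤n; s≤s; s≤s⁻¹)
open import Data.Nat.Properties
open import Data.Nat.Tactic.RingSolver using (solve-∀)
open import Data.List using (length; filter; drop)
open import Data.List.Properties using (filter-accept; filter-reject; filter-all; filter-none; length-drop)
open import Data.List.Relation.Unary.All as All using (All; []; _∷_)
open import Data.List.Relation.Unary.All.Properties using (drop⁺)
open import Data.List.Relation.Unary.Linked as Linked using (Linked; []; [-]; _∷_)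
open import Data.List.Relation.Unary.Linked.Properties using (Linked⇒All)
open import Data.Product using (Σ; _,_; proj₂)
open import Data.Sum using (_⊎_; inj₁; inj₂)
open import Relation.Nullary using (yes; no; contradiction)
open import Relation.Binary.PropositionalEquality
open import Relation.Binary using (tri<; tri≈; tri>)

-- atLeast j t is the number of entries of t that are ≥ j.  The leg of box (i , j) of λ is
-- atLeast j (drop i λ).
atLeast : ℕ → List ℕ → ℕ
atLeast j t = length (filter (j ≤?_) t)

atLeast-accept : ∀ {j y} ys → j ≤ y → atLeast j (y ∷ ys) ≡ suc (atLeast j ys)
atLeast-accept {j} _ j≤y = cong length (filter-accept (j ≤?_) j≤y)

atLeast-reject : ∀ {j y} ys → j ≰ y → atLeast j (y ∷ ys) ≡ atLeast j ys
atLeast-reject {j} _ j≰y = cong length (filter-reject (j ≤?_) j≰y)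

atLeast-antitone : ∀ {j j'} t → j ≤ j' → atLeast j' t ≤ atLeast j t
atLeast-antitone [] _ = z≤n
atLeast-antitone {j} {j'} (y ∷ ys) j≤j' with j' ≤? y | j ≤? y
... | yes j'≤y | yes j≤y =
  subst₂ _≤_ (sym (atLeast-accept ys j'≤y)) (sym (atLeast-accept ys j≤y)) (s≤s (atLeast-antitone ys j≤j'))
... | yes j'≤y | no j≰y  = contradiction (≤-trans j≤j' j'≤y) j≰y
... | no j'≰y  | yes j≤y =
  subst₂ _≤_ (sym (atLeast-reject ys j'≰y)) (sym (atLeast-accept ys j≤y)) (m≤n⇒m≤1+n (atLeast-antitone ys j≤j'))
... | no j'≰y  | no j≰y  =
  subst₂ _≤_ (sym (atLeast-reject ys j'≰y)) (sym (atLeast-reject ys j≰y)) (atLeast-antitone ys j≤j')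

atLeast-positive : ∀ {t} → All (0 <_) t → atLeast 1 t ≡ length t
atLeast-positive pos = cong length (filter-all (1 ≤?_) pos)

atLeast-above : ∀ {j t} → All (_< j) t → atLeast j t ≡ 0
atLeast-above {j} below = cong length (filter-none (j ≤?_) (All.map <⇒≱ below))

below-head : ∀ {y ys j} → Linked _>_ (y ∷ ys) → y ≤ j → All (_< j) ys
below-head [-]         _   = []
below-head (y>z ∷ dec) y≤j =
  All.map (λ z<y → <-≤-trans z<y y≤j) (Linked⇒All (λ p q → <-trans q p) y>z dec)

-- A strictly decreasing list contains j at most once, so lowering the threshold from
-- j + 1 to j gains at most one entry.
atLeast-step : ∀ j {t} → Linked _>_ t → atLeast j t ≤ suc (atLeast (suc j) t)
atLeast-step j {[]} _ = z≤n
atLeast-step j {y ∷ ys} dec with <-cmp j y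
... | tri< j<y _ _ =
  subst₂ _≤_ (sym (atLeast-accept ys (<⇒≤ j<y))) (cong suc (sym (atLeast-accept ys j<y)))
    (s≤s (atLeast-step j (Linked.tail dec)))
... | tri≈ _ refl _ =
  subst (_≤ suc (atLeast (suc j) (j ∷ ys)))
    (sym (trans (atLeast-accept ys (≤-refl {j})) (cong suc (atLeast-above (below-head dec ≤-refl)))))
    (s≤s z≤n)
... | tri> _ _ y<j =
  subst₂ _≤_ (sym (atLeast-reject ys (<⇒≱ y<j))) (cong suc (sym (atLeast-reject ys (<⇒≱ (m<n⇒m<1+n y<j)))))
    (atLeast-step j (Linked.tail dec))

-- Hook length of box (1 , j) in a diagram whose first row has length x and whose lower
-- rows are t.  Definitionally hook λ i j = rowHook (part λ i) (drop i λ) j.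
rowHook : ℕ → List ℕ → ℕ → ℕ
rowHook x t j = (x ∸ j) + atLeast j t + 1

rowHook-antitone : ∀ x t {j j'} → j ≤ j' → rowHook x t j' ≤ rowHook x t j
rowHook-antitone x t j≤j' =
  +-monoˡ-≤ 1 (+-mono-≤ (∸-monoʳ-≤ x j≤j') (atLeast-antitone t j≤j'))

rowHook-step : ∀ {x t j} → Linked _>_ (x ∷ t) → j < x → rowHook x t j ≤ 2 + rowHook x t (suc j)
rowHook-step {x} {t} {j} dec j<x = begin
    (x ∸ j) + atLeast j t + 1
  ≡⟨ cong (λ a → a + atLeast j t + 1) (+-∸-assoc 1 j<x) ⟩
    suc (x ∸ suc j) + atLeast j t + 1
  ≤⟨ +-monoˡ-≤ 1 (+-monoʳ-≤ (suc (x ∸ suc j)) (atLeast-step j {t} (Linked.tail dec))) ⟩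
    suc (x ∸ suc j) + suc (atLeast (suc j) t) + 1
  ≡⟨ cong (λ a → suc a + 1) (+-suc (x ∸ suc j) (atLeast (suc j) t)) ⟩
    2 + rowHook x t (suc j)
  ∎
  where open ≤-Reasoning

rowHook-last : ∀ {x t} → Linked _>_ (x ∷ t) → rowHook x t x ≡ 1
rowHook-last {x} dec =
  cong₂ (λ a c → a + c + 1) (n∸n≡0 x) (atLeast-above (below-head dec ≤-refl))

rowHook-first : ∀ {x t} → 0 < x → All (0 <_) t → rowHook x t 1 ≡ x + length t
rowHook-first {suc x} {t} _ pos = begin
    x + atLeast 1 t + 1   ≡⟨ cong (λ c → x + c + 1) (atLeast-positive pos) ⟩
    x + length t + 1      ≡⟨ +-comm (x + length t) 1 ⟩
    suc x + length t      ∎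
  where open ≡-Reasoning

hitsBand : (f : ℕ → ℕ) (s n : ℕ) → (∀ j → j < n → f j ≤ 2 + f (suc j)) →
           s ≤ f 0 → f n ≤ s → Σ ℕ λ j → j ≤ n × (f j ≡ s ⊎ f j ≡ suc s)
hitsBand f s zero _ s≤f0 f0≤s = 0 , z≤n , inj₁ (≤-antisym f0≤s s≤f0)
hitsBand f s (suc n) slow s≤f0 fn≤s with f 0 ≤? suc s
... | yes f0≤1+s = 0 , z≤n , inBand (m≤n⇒m<n∨m≡n s≤f0)
  where
  inBand : s < f 0 ⊎ s ≡ f 0 → f 0 ≡ s ⊎ f 0 ≡ suc s
  inBand (inj₁ s<f0) = inj₂ (≤-antisym f0≤1+s s<f0)
  inBand (inj₂ s≡f0) = inj₁ (sym s≡f0)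
... | no f0≰1+s =
  let s≤f1 = s≤s⁻¹ (s≤s⁻¹ (≤-trans (≰⇒> f0≰1+s) (slow 0 (s≤s z≤n))))
      (j , j≤n , hit) = hitsBand (λ j → f (suc j)) s n (λ j j<n → slow (suc j) (s≤s j<n)) s≤f1 fn≤s
  in  suc j , s≤s j≤n , hit

row-hitsBand : ∀ {x t s} → Linked _>_ (x ∷ t) → 0 < x → 1 ≤ s → s ≤ rowHook x t 1 →
               Σ ℕ λ j → 1 ≤ j × j ≤ x × (rowHook x t j ≡ s ⊎ rowHook x t j ≡ suc s)
row-hitsBand {suc x} {t} {s} dec _ 1≤s s≤first =
  let (j , j≤x , hit) = hitsBand (λ j → rowHook (suc x) t (suc j)) s x
                          (λ j j<x → rowHook-step dec (s≤s j<x))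
                          s≤first (subst (_≤ s) (sym (rowHook-last dec)) 1≤s)
  in  suc j , s≤s z≤n , s≤s j≤x , hit

drop-row : ∀ i λs → suc i ≤ length λs → drop i λs ≡ part λs (suc i) ∷ drop (suc i) λs
drop-row zero    (y ∷ ys) _        = refl
drop-row (suc i) (y ∷ ys) (s≤s le) = drop-row i ys le

linked-drop : ∀ {R : ℕ → ℕ → Set} n {xs} → Linked R xs → Linked R (drop n xs)
linked-drop zero            l = l
linked-drop (suc n) {[]}    l = l
linked-drop (suc n) {_ ∷ _} l = linked-drop n (Linked.tail l)

linked-row : ∀ {R : ℕ → ℕ → Set} {λs} i → Linked R λs → suc i ≤ length λs →
             Linked R (part λs (suc i) ∷ drop (suc i) λs)
linked-row {R} {λs} i l le = subst (Linked R) (drop-row i λs le) (linked-drop i l)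

linked-adjacent : ∀ {R : ℕ → ℕ → Set} {λs} i → Linked R λs → suc (suc i) ≤ length λs →
                  R (part λs (suc i)) (part λs (suc (suc i)))
linked-adjacent {R} {λs} i l le =
  Linked.head (subst (λ t → Linked R (part λs (suc i) ∷ t)) (drop-row (suc i) λs le)
                     (linked-row i l (≤-trans (n≤1+n _) le)))

row-positive : ∀ {λs} i → All (0 <_) λs → suc i ≤ length λs → 0 < part λs (suc i)
row-positive {λs} i pos le = All.head (subst (All (0 <_)) (drop-row i λs le) (drop⁺ i pos))

ddistinct⇒linked : ∀ {d} λs → DDistinct d λs → Linked (λ a b → d + b ≤ a) λs
ddistinct⇒linked []           _  = []
ddistinct⇒linked (x ∷ [])     _  = [-]
ddistinct⇒linked {d} (x ∷ y ∷ ys) dd = dd 1 ≤-refl (s≤s (s≤s z≤n)) ∷ ddistinct⇒linked (y ∷ ys) below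
  where
  below : DDistinct d (y ∷ ys)
  below (suc i) _ le = dd (suc (suc i)) (s≤s z≤n) (s≤s le)

ddistinct⇒decreasing : ∀ {d} λs → 1 ≤ d → DDistinct d λs → Linked _>_ λs
ddistinct⇒decreasing λs 1≤d dd =
  Linked.map (λ gap → ≤-trans (+-monoˡ-≤ _ 1≤d) gap) (ddistinct⇒linked λs dd)

betaNum : List ℕ → ℕ → ℕ
betaNum λs i = part λs i + (length λs ∸ i)

hook-firstColumn : ∀ {λs} i → All (0 <_) λs → suc i ≤ length λs →
                   hook λs (suc i) 1 ≡ betaNum λs (suc i)
hook-firstColumn {λs} i pos le =
  trans (rowHook-first (row-positive i pos le) (drop⁺ (suc i) pos))
        (cong (part λs (suc i) +_) (length-drop (suc i) λs))

ddistinct⇔betaGap : ∀ d {λs} i → suc (suc i) ≤ length λs →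
  (d + part λs (suc (suc i)) ≤ part λs (suc i)) ⇔
  (betaNum λs (suc (suc i)) + suc d ≤ betaNum λs (suc i))
ddistinct⇔betaGap d {λs} i le =
  mk⇔ (λ p → subst₂ _≤_ (sym shuffle) (sym lengths) (+-monoˡ-≤ (suc L) p))
      (λ q → +-cancelʳ-≤ (suc L) _ _ (subst₂ _≤_ shuffle lengths q))
  where
  L = length λs ∸ suc (suc i)
  lengths : betaNum λs (suc i) ≡ part λs (suc i) + suc L
  lengths = cong (part λs (suc i) +_) (+-∸-assoc 1 le)
  rearrange : ∀ p l d → p + l + suc d ≡ d + p + suc l
  rearrange = solve-∀
  shuffle : betaNum λs (suc (suc i)) + suc d ≡ d + part λs (suc (suc i)) + suc L
  shuffle = rearrange (part λs (suc (suc i))) L d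

Spread : ℕ → ℕ → (ℕ → ℕ) → Set
Spread g n b = ∀ {i j} → i < j → j < n → b j + g ≤ b i

consecutive⇒spread : ∀ g n (b : ℕ → ℕ) → (∀ i → suc i < n → b (suc i) + g ≤ b i) → Spread g n b
consecutive⇒spread g n b step {j = zero} () _
consecutive⇒spread g n b step {i} {suc j} i<1+j 1+j<n with m<1+n⇒m<n∨m≡n i<1+j
... | inj₂ refl = step i 1+j<n
... | inj₁ i<j  = ≤-trans (step j 1+j<n)
                    (≤-trans (m≤m+n (b j) g)
                             (consecutive⇒spread g n b step i<j (<-trans (n<1+n j) 1+j<n)))

spread⇒twinFree : ∀ d n (b : ℕ → ℕ) (X : ℕ → Set) → Spread (suc d) n b →
                  (∀ x → X x → Σ ℕ λ i → i < n × b i ≡ x) → TwinFree d X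
spread⇒twinFree d n b X spread enum (x , k , 1≤k , k≤d , Xx , Xx+k)
  with enum x Xx | enum (x + k) Xx+k
... | i , i<n , refl | j , j<n , bj≡x+k with <-cmp i j
... | tri≈ _ refl _ = <-irrefl bj≡x+k (m<m+n (b i) 1≤k)
... | tri< i<j _ _  =
  m+1+n≰m (b i) (≤-trans (+-monoˡ-≤ (suc d) (subst (b i ≤_) (sym bj≡x+k) (m≤m+n (b i) k)))
                         (spread i<j j<n))
... | tri> _ _ j<i  =
  n≮n d (+-cancelˡ-≤ (b i) _ _
          (≤-trans (spread j<i i<n) (subst (_≤ b i + d) (sym bj≡x+k) (+-monoʳ-≤ (b i) k≤d))))

twinFree-gap : ∀ {d} {X : ℕ → Set} {x y} → TwinFree d X → X x → X y → x < y → x + d < y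
twinFree-gap {d} {X} {x} {y} tf Xx Xy x<y with y ≤? x + d
... | no y≰x+d  = ≰⇒> y≰x+d
... | yes y≤x+d = contradiction (x , y ∸ x , m<n⇒0<n∸m x<y , y∸x≤d , Xx , subst X (sym x+[y∸x]≡y) Xy) tf
  where
  x+[y∸x]≡y : x + (y ∸ x) ≡ y
  x+[y∸x]≡y = m+[n∸m]≡n (<⇒≤ x<y)
  y∸x≤d : y ∸ x ≤ d
  y∸x≤d = +-cancelˡ-≤ x _ _ (subst (_≤ x + d) (sym x+[y∸x]≡y) y≤x+d)

ddistinct⇒twinFree : ∀ d λs → All (0 <_) λs → DDistinct d λs → TwinFree d (β λs)
ddistinct⇒twinFree d λs pos dd =
  spread⇒twinFree d (length λs) b (β λs) (consecutive⇒spread (suc d) (length λs) b gap) enumerate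
  where
  b : ℕ → ℕ
  b i = betaNum λs (suc i)
  gap : ∀ i → suc i < length λs → b (suc i) + suc d ≤ b i
  gap i le = Equivalence.to (ddistinct⇔betaGap d {λs} i le) (dd (suc i) (s≤s z≤n) le)
  enumerate : ∀ x → β λs x → Σ ℕ λ i → i < length λs × b i ≡ x
  enumerate x (zero  , ()  , _)
  enumerate x (suc i , _ , le , hx) = i , le , trans (sym (hook-firstColumn i pos le)) hx

twinFree⇒ddistinct : ∀ d λs → All (0 <_) λs → Linked _≥_ λs → TwinFree d (β λs) → DDistinct d λs
twinFree⇒ddistinct d λs pos nonincr tf zero () _
twinFree⇒ddistinct d λs pos nonincr tf (suc i) _ le =
  Equivalence.from (ddistinct⇔betaGap d {λs} i le)
    (subst (_≤ betaNum λs (suc i)) (sym (+-suc _ d)) (twinFree-gap tf (inβ (suc i) le) (inβ i il) lower))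
  where
  il : suc i ≤ length λs
  il = ≤-trans (n≤1+n _) le
  inβ : ∀ r → suc r ≤ length λs → β λs (betaNum λs (suc r))
  inβ r rl = suc r , s≤s z≤n , rl , hook-firstColumn r pos rl
  lower : betaNum λs (suc (suc i)) < betaNum λs (suc i)
  lower = subst (_≤ betaNum λs (suc i)) (+-comm _ 1)
            (Equivalence.to (ddistinct⇔betaGap 0 {λs} i le) (linked-adjacent i nonincr le))

core⇒betaBounded : ∀ {d} s λs → 1 ≤ d → 1 ≤ s → All (0 <_) λs →
                   IsCore (s ∷ suc s ∷ []) λs → DDistinct d λs → SubsetUpTo (s ∸ 1) (β λs)
core⇒betaBounded s λs _ _ _ _ _ _ (zero , () , _)
core⇒betaBounded (suc s) λs 1≤d _ pos (no-s ∷ no-s+1 ∷ []) dd _ (suc i , 1≤i , i≤l , refl) =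
  m≤n+m 1 _ , bounded
  where
  bounded : hook λs (suc i) 1 ≤ s
  bounded with suc s ≤? hook λs (suc i) 1
  ... | no h≱s+1 = s≤s⁻¹ (≰⇒> h≱s+1)
  ... | yes s+1≤h with row-hitsBand (linked-row i (ddistinct⇒decreasing λs 1≤d dd) i≤l)
                                    (row-positive i pos i≤l) (s≤s z≤n) s+1≤h
  ...   | j , 1≤j , j≤x , inj₁ h≡s+1 = contradiction h≡s+1 (no-s (suc i) j (1≤i , i≤l , 1≤j , j≤x))
  ...   | j , 1≤j , j≤x , inj₂ h≡s+2 = contradiction h≡s+2 (no-s+1 (suc i) j (1≤i , i≤l , 1≤j , j≤x))

-- If all β-numbers are below s then so are all hooks, and λ is an (s, s+1)-core.
betaBounded⇒core : ∀ s λs → 1 ≤ s → SubsetUpTo (s ∸ 1) (β λs) → IsCore (s ∷ suc s ∷ []) λs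
betaBounded⇒core (suc s) λs _ bounded = avoid ≤-refl ∷ avoid (n≤1+n _) ∷ []
  where
  hook≤s : ∀ i j → Box λs i j → hook λs i j ≤ s
  hook≤s i j (1≤i , i≤l , 1≤j , _) =
    ≤-trans (rowHook-antitone (part λs i) (drop i λs) 1≤j) (proj₂ (bounded _ (i , 1≤i , i≤l , refl)))
  avoid : ∀ {t} → suc s ≤ t → ∀ i j → Box λs i j → hook λs i j ≢ t
  avoid s+1≤t i j box refl = ≤⇒≯ (hook≤s i j box) s+1≤t

lemma3 : (d s : ℕ) → 1 ≤ d → 1 ≤ s → (λs : List ℕ) → IsPartition λs →
    (IsCore (s ∷ suc s ∷ []) λs × DDistinct d λs) ⇔ (TwinFree d (β λs) × SubsetUpTo (s ∸ 1) (β λs))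
lemma3 d s 1≤d 1≤s λs (pos , nonincr) = mk⇔
  (λ { (core , dd) → ddistinct⇒twinFree d λs pos dd , core⇒betaBounded s λs 1≤d 1≤s pos core dd })
  (λ { (tf , bounded) → betaBounded⇒core s λs 1≤s bounded , twinFree⇒ddistinct d λs pos nonincr tf })
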